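{- For every integer $n \geq 5$, $\gamma_R(P(n,2)) \geq \left\lceil \frac{8n}{7} \right\rceil$.
   Context: For integers $n$ and $k$, the generalized Petersen graph $P(n,k)$ is the graph with vertex set $\{v_i, u_i : 0 \leq i \leq n-1\}$ and edge set $\{v_i v_{i+1}, v_i u_i, u_i u_{i+k} : 0 \leq i \leq n-1\}$, subscripts taken modulo $n$. A Roman domination function (RDF) on a graph $G$ is a function $f: V(G) \to \{0,1,2\}$ such that every vertex $u$ with $f(u)=0$ is adjacent to at least one vertex $v$ with $f(v)=2$. Its weight is $\sum_{u \in V(G)} f(u)$. The Roman domination number $\gamma_R(G)$ is the minimum weight of an RDF on $G$. -}

module Defs where

open import Data.Nat using (ℕ; suc; _+_; _*_; _≤_; NonZero)
open import Data.Nat.DivMod using (_%_; _/_; m%n<n)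
open import Data.Fin using (Fin; toℕ; fromℕ<)
open import Data.Sum using (_⊎_; inj₁; inj₂)
open import Data.Product using (Σ; _×_; ∃)
open import Data.List using (List; map; _++_)
open import Data.Nat.ListAction using (sum)
open import Data.Fin.Base using () 
open import Data.List.Base using (allFin)
open import Relation.Binary.PropositionalEquality using (_≡_)

-- Vertices of the generalized Petersen graph P(n,k):
-- inj₁ i stands for v_i (outer), inj₂ i stands for u_i (inner), i ∈ {0,…,n-1}.
Vertex : ℕ → Set
Vertex n = Fin n ⊎ Fin n

_+ₘ_ : ∀ {n} .{{_ : NonZero n}} → Fin n → ℕ → Fin n
_+ₘ_ {n} i m = fromℕ< (m%n<n (toℕ i + m) n)

data Edge (n k : ℕ) .{{_ : NonZero n}} : Vertex n → Vertex n → Set where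
  outer : (i : Fin n) → Edge n k (inj₁ i) (inj₁ (i +ₘ 1))
  spoke : (i : Fin n) → Edge n k (inj₁ i) (inj₂ i)
  inner : (i : Fin n) → Edge n k (inj₂ i) (inj₂ (i +ₘ k))

Adj : (n k : ℕ) .{{_ : NonZero n}} → Vertex n → Vertex n → Set
Adj n k x y = Edge n k x y ⊎ Edge n k y x

allVertices : (n : ℕ) → List (Vertex n)
allVertices n = map inj₁ (allFin n) ++ map inj₂ (allFin n)

record IsRDF (n k : ℕ) .{{_ : NonZero n}} (f : Vertex n → ℕ) : Set where
  field
    bounded   : ∀ x → f x ≤ 2
    dominated : ∀ x → f x ≡ 0 → ∃ λ y → Adj n k x y × f y ≡ 2

weight : (n : ℕ) → (Vertex n → ℕ) → ℕ
weight n f = sum (map f (allVertices n))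

-- "γ_R(P(n,k)) ≥ c": every RDF on P(n,k) has weight at least c
-- (γ_R is the minimum weight of an RDF, which exists since the graph is finite)
γR≥ : (n k : ℕ) .{{_ : NonZero n}} → ℕ → Set
γR≥ n k c = ∀ f → IsRDF n k f → c ≤ weight n f

⌈_/_⌉ : ℕ → (b : ℕ) .{{_ : NonZero b}} → ℕ
⌈ a / b ⌉ = (a + (b Data.Nat.∸ 1)) / b

-- Record for each vertex only whether f gives it the value 2. There is a potential Φ on the
-- pattern of 2s in the window u_j, v_{j+1}, u_{j+1}, v_{j+2}, u_{j+2}, u_{j+3} such that every
-- RDF satisfies
--   8 + Φ(window j) ≤ 7 · (f(v_{j+2}) + f(u_{j+2})) + Φ(window j+1);
-- this is a finite check that only uses the domination of v_{j+2} and u_{j+2}. Summing over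
-- j ∈ ℤ/n the potentials cancel, leaving 8n ≤ 7 · weight f.
module Submission where

open import Defs
open import Data.Nat using (ℕ; _*_; _≤_; NonZero; zero; suc; pred; _+_; _<_; _≡ᵇ_; _≟_; _≤?_; s≤s; z≤n; s≤s⁻¹; _%_)
open import Data.Nat.Properties
open import Data.Nat.DivMod using (%-distribˡ-+; m%n%n≡m%n; [m+kn]%n≡m%n; m<n⇒m%n≡m; m<n*o⇒m/o<n)
import Data.Nat.ListAction as List
open import Data.Nat.ListAction.Properties using (sum-++)
open import Data.Bool using (Bool; true; false; T)
open import Data.Bool.Properties using (T?)
open import Data.Fin as Fin using (Fin; toℕ)
open import Data.Fin.Properties using (toℕ-injective; toℕ-fromℕ<; toℕ<n)
open import Data.Fin.Permutation using (Permutation′; permutation)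
open import Data.Sum using (_⊎_; inj₁; inj₂)
open import Data.Product using (_×_; _,_; ∃-syntax)
open import Data.List using (map; _++_; tabulate; allFin)
open import Data.List.Properties using (map-++; map-∘; map-tabulate)
open import Algebra.Properties.Semiring.Sum +-*-semiring
  using (sum; sum-syntax; ∑-distrib-+; sum-permute; *-distribˡ-sum)
open import Function using (id; _∘_)
open import Relation.Binary.PropositionalEquality
open import Relation.Nullary.Decidable using (Dec; map′; _×-dec_; _⊎-dec_; _→-dec_; toWitness)

module _ {n : ℕ} .{{_ : NonZero n}} where

  [m%n+k]%n≡[m+k]%n : ∀ m k → (m % n + k) % n ≡ (m + k) % n
  [m%n+k]%n≡[m+k]%n m k = begin
    (m % n + k) % n           ≡⟨ %-distribˡ-+ (m % n) k n ⟩
    (m % n % n + k % n) % n   ≡⟨ cong (λ x → (x + k % n) % n) (m%n%n≡m%n m n) ⟩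
    (m % n + k % n) % n       ≡⟨ %-distribˡ-+ m k n ⟨
    (m + k) % n               ∎
    where open ≡-Reasoning

  toℕ-+ₘ : ∀ (i : Fin n) m → toℕ (i +ₘ m) ≡ (toℕ i + m) % n
  toℕ-+ₘ i m = toℕ-fromℕ< _

  +ₘ-assoc : ∀ (i : Fin n) a b → (i +ₘ a) +ₘ b ≡ i +ₘ (a + b)
  +ₘ-assoc i a b = toℕ-injective (begin
    toℕ ((i +ₘ a) +ₘ b)          ≡⟨ toℕ-+ₘ (i +ₘ a) b ⟩
    (toℕ (i +ₘ a) + b) % n      ≡⟨ cong (λ x → (x + b) % n) (toℕ-+ₘ i a) ⟩
    ((toℕ i + a) % n + b) % n   ≡⟨ [m%n+k]%n≡[m+k]%n (toℕ i + a) b ⟩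
    (toℕ i + a + b) % n         ≡⟨ cong (_% n) (+-assoc (toℕ i) a b) ⟩
    (toℕ i + (a + b)) % n       ≡⟨ toℕ-+ₘ i (a + b) ⟨
    toℕ (i +ₘ (a + b))           ∎)
    where open ≡-Reasoning

  +ₘ-period : ∀ (i : Fin n) k → i +ₘ (k * n) ≡ i
  +ₘ-period i k = toℕ-injective (begin
    toℕ (i +ₘ (k * n))     ≡⟨ toℕ-+ₘ i (k * n) ⟩
    (toℕ i + k * n) % n   ≡⟨ [m+kn]%n≡m%n (toℕ i) k n ⟩
    toℕ i % n             ≡⟨ m<n⇒m%n≡m (toℕ<n i) ⟩
    toℕ i                 ∎)
    where open ≡-Reasoning

  m+m*pred[n]≡m*n : ∀ m → m + m * pred n ≡ m * n
  m+m*pred[n]≡m*n m = trans (sym (*-suc m (pred n))) (cong (m *_) (suc-pred n))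

  +ₘ-inverseʳ : ∀ m (i : Fin n) → (i +ₘ m) +ₘ (m * pred n) ≡ i
  +ₘ-inverseʳ m i = begin
    (i +ₘ m) +ₘ (m * pred n)  ≡⟨ +ₘ-assoc i m (m * pred n) ⟩
    i +ₘ (m + m * pred n)     ≡⟨ cong (i +ₘ_) (m+m*pred[n]≡m*n m) ⟩
    i +ₘ (m * n)              ≡⟨ +ₘ-period i m ⟩
    i                         ∎
    where open ≡-Reasoning

  +ₘ-inverseˡ : ∀ m (i : Fin n) → (i +ₘ (m * pred n)) +ₘ m ≡ i
  +ₘ-inverseˡ m i = begin
    (i +ₘ (m * pred n)) +ₘ m  ≡⟨ +ₘ-assoc i (m * pred n) m ⟩
    i +ₘ (m * pred n + m)     ≡⟨ cong (i +ₘ_) (trans (+-comm (m * pred n) m) (m+m*pred[n]≡m*n m)) ⟩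
    i +ₘ (m * n)              ≡⟨ +ₘ-period i m ⟩
    i                         ∎
    where open ≡-Reasoning

  +ₘ-injective : ∀ m {i j : Fin n} → i +ₘ m ≡ j +ₘ m → i ≡ j
  +ₘ-injective m {i} {j} eq = begin
    i                         ≡⟨ +ₘ-inverseʳ m i ⟨
    (i +ₘ m) +ₘ (m * pred n)  ≡⟨ cong (_+ₘ (m * pred n)) eq ⟩
    (j +ₘ m) +ₘ (m * pred n)  ≡⟨ +ₘ-inverseʳ m j ⟩
    j                         ∎
    where open ≡-Reasoning

  +ₘ-permutation : ℕ → Permutation′ n
  +ₘ-permutation m = permutation (_+ₘ m) (_+ₘ (m * pred n)) (+ₘ-inverseˡ m) (+ₘ-inverseʳ m)

  ∑-+ₘ : ∀ (g : Fin n → ℕ) m → ∑[ i < n ] g (i +ₘ m) ≡ ∑[ i < n ] g i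
  ∑-+ₘ g m = sym (sum-permute g (+ₘ-permutation m))

∑-const : ∀ n c → ∑[ i < n ] c ≡ n * c
∑-const zero    c = refl
∑-const (suc n) c = cong (c +_) (∑-const n c)

∑-mono-≤ : ∀ {n} {g h : Fin n → ℕ} → (∀ i → g i ≤ h i) → ∑[ i < n ] g i ≤ ∑[ i < n ] h i
∑-mono-≤ {zero}  _   = z≤n
∑-mono-≤ {suc n} g≤h = +-mono-≤ (g≤h Fin.zero) (∑-mono-≤ (g≤h ∘ Fin.suc))

potential-lower-bound : ∀ {n} .{{_ : NonZero n}} c (w g : Fin n → ℕ) →
                        (∀ i → c + g i ≤ w i + g (i +ₘ 1)) → n * c ≤ ∑[ i < n ] w i
potential-lower-bound {n} c w g step = +-cancelʳ-≤ (∑[ i < n ] g i) (n * c) (∑[ i < n ] w i) (begin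
  n * c + ∑[ i < n ] g i                    ≡⟨ cong (_+ ∑[ i < n ] g i) (∑-const n c) ⟨
  ∑[ i < n ] c + ∑[ i < n ] g i             ≡⟨ ∑-distrib-+ (λ _ → c) g ⟨
  ∑[ i < n ] (c + g i)                      ≤⟨ ∑-mono-≤ step ⟩
  ∑[ i < n ] (w i + g (i +ₘ 1))             ≡⟨ ∑-distrib-+ w (λ i → g (i +ₘ 1)) ⟩
  ∑[ i < n ] w i + ∑[ i < n ] g (i +ₘ 1)    ≡⟨ cong (∑[ i < n ] w i +_) (∑-+ₘ g 1) ⟩
  ∑[ i < n ] w i + ∑[ i < n ] g i           ∎)
  where open ≤-Reasoning

sum-tabulate : ∀ {n} (h : Fin n → ℕ) → List.sum (tabulate h) ≡ ∑[ i < n ] h i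
sum-tabulate {zero}  h = refl
sum-tabulate {suc n} h = cong (h Fin.zero +_) (sum-tabulate (h ∘ Fin.suc))

sum-map-allFin : ∀ {n} (h : Fin n → ℕ) → List.sum (map h (allFin n)) ≡ ∑[ i < n ] h i
sum-map-allFin h = trans (cong List.sum (map-tabulate id h)) (sum-tabulate h)

weight≡∑columns : ∀ n (f : Vertex n → ℕ) → weight n f ≡ ∑[ i < n ] (f (inj₁ i) + f (inj₂ i))
weight≡∑columns n f = begin
  List.sum (map f (map inj₁ (allFin n) ++ map inj₂ (allFin n)))
    ≡⟨ cong List.sum (map-++ f (map inj₁ (allFin n)) (map inj₂ (allFin n))) ⟩
  List.sum (map f (map inj₁ (allFin n)) ++ map f (map inj₂ (allFin n)))
    ≡⟨ sum-++ (map f (map inj₁ (allFin n))) (map f (map inj₂ (allFin n))) ⟩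
  List.sum (map f (map inj₁ (allFin n))) + List.sum (map f (map inj₂ (allFin n)))
    ≡⟨ cong₂ _+_ (cong List.sum (map-∘ (allFin n))) (cong List.sum (map-∘ (allFin n))) ⟨
  List.sum (map (f ∘ inj₁) (allFin n)) + List.sum (map (f ∘ inj₂) (allFin n))
    ≡⟨ cong₂ _+_ (sum-map-allFin (f ∘ inj₁)) (sum-map-allFin (f ∘ inj₂)) ⟩
  ∑[ i < n ] f (inj₁ i) + ∑[ i < n ] f (inj₂ i)
    ≡⟨ ∑-distrib-+ (f ∘ inj₁) (f ∘ inj₂) ⟨
  ∑[ i < n ] (f (inj₁ i) + f (inj₂ i))
    ∎
  where open ≡-Reasoning

module _ {n k : ℕ} .{{_ : NonZero n}} where

  outer-neighbour : ∀ {x y} → Adj n k (inj₁ x) y →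
                    y ≡ inj₁ (x +ₘ 1) ⊎ y ≡ inj₂ x ⊎ ∃[ i ] y ≡ inj₁ i × i +ₘ 1 ≡ x
  outer-neighbour (inj₁ (outer _)) = inj₁ refl
  outer-neighbour (inj₁ (spoke _)) = inj₂ (inj₁ refl)
  outer-neighbour (inj₂ (outer i)) = inj₂ (inj₂ (i , refl , refl))

  inner-neighbour : ∀ {x y} → Adj n k (inj₂ x) y →
                    y ≡ inj₂ (x +ₘ k) ⊎ y ≡ inj₁ x ⊎ ∃[ i ] y ≡ inj₂ i × i +ₘ k ≡ x
  inner-neighbour (inj₁ (inner _)) = inj₁ refl
  inner-neighbour (inj₂ (spoke _)) = inj₂ (inj₁ refl)
  inner-neighbour (inj₂ (inner i)) = inj₂ (inj₂ (i , refl , refl))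

all-Bool? : {P : Bool → Set} → (∀ b → Dec (P b)) → Dec (∀ b → P b)
all-Bool? P? = map′ (λ { (pf , pt) false → pf ; (pf , pt) true → pt })
                    (λ ∀P → ∀P false , ∀P true)
                    (P? false ×-dec P? true)

is2 : ℕ → Bool
is2 m = m ≡ᵇ 2

-- The arguments are the 2-indicators of u_j, v_{j+1}, u_{j+1}, v_{j+2}, u_{j+2}, u_{j+3}.
-- The values are longest-path lengths in the digraph of such patterns, with an arc for each
-- one-column extension dominating column j+2, weighted 8 − 7 · (weight of column j+2);
-- they exist because this digraph has no cycle of positive weight.
Φ : Bool → Bool → Bool → Bool → Bool → Bool → ℕ
Φ true  true  true  _     _     _     = 0
Φ true  true  false _     _     _     = 1
Φ true  false true  _     _     _     = 7
Φ true  false false false _     _     = 8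
Φ true  false false true  _     _     = 15
Φ false true  true  _     false _     = 0
Φ false true  true  _     true  _     = 6
Φ false true  false _     false _     = 10
Φ false true  false _     true  _     = 13
Φ false false true  _     false _     = 7
Φ false false true  _     true  _     = 13
Φ false false false false false false = 11
Φ false false false false false true  = 18
Φ false false false false true  false = 12
Φ false false false false true  true  = 19
Φ false false false true  false false = 16
Φ false false false true  false true  = 19
Φ false false false true  true  false = 19
Φ false false false true  true  true  = 26

Φ-step : ∀ {a} → a < 3 → ∀ {b} → b < 3 → ∀ u₀ v₁ u₁ v₃ u₃ u₄ →
         (a ≡ 0 → T v₁ ⊎ T v₃ ⊎ T (is2 b)) → (b ≡ 0 → T u₀ ⊎ T u₄ ⊎ T (is2 a)) →
         8 + Φ u₀ v₁ u₁ (is2 a) (is2 b) u₃ ≤ 7 * (a + b) + Φ u₁ (is2 a) (is2 b) v₃ u₃ u₄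
Φ-step = toWitness {a? = allUpTo? (λ a → allUpTo? (λ b →
  all-Bool? λ u₀ → all-Bool? λ v₁ → all-Bool? λ u₁ → all-Bool? λ v₃ → all-Bool? λ u₃ → all-Bool? λ u₄ →
    ((a ≟ 0) →-dec (T? v₁ ⊎-dec T? v₃ ⊎-dec T? (is2 b))) →-dec
    ((b ≟ 0) →-dec (T? u₀ ⊎-dec T? u₄ ⊎-dec T? (is2 a))) →-dec
    (8 + Φ u₀ v₁ u₁ (is2 a) (is2 b) u₃ ≤? 7 * (a + b) + Φ u₁ (is2 a) (is2 b) v₃ u₃ u₄)) 3) 3} _

module _ {n : ℕ} .{{_ : NonZero n}} {f : Vertex n → ℕ} (rdf : IsRDF n 2 f) where
  open IsRDF rdf

  two : Vertex n → Bool
  two x = is2 (f x)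

  two-at : ∀ {x y} → f y ≡ 2 → y ≡ x → T (two x)
  two-at fy≡2 refl = ≡⇒≡ᵇ _ 2 fy≡2

  outer-dominated : ∀ j → f (inj₁ (j +ₘ 2)) ≡ 0 →
                    T (two (inj₁ (j +ₘ 1))) ⊎ T (two (inj₁ (j +ₘ 3))) ⊎ T (two (inj₂ (j +ₘ 2)))
  outer-dominated j f≡0 with dominated (inj₁ (j +ₘ 2)) f≡0
  ... | y , adj , fy≡2 with outer-neighbour adj
  ... | inj₁ y≡ = inj₂ (inj₁ (two-at fy≡2 (trans y≡ (cong inj₁ (+ₘ-assoc j 2 1)))))
  ... | inj₂ (inj₁ y≡) = inj₂ (inj₂ (two-at fy≡2 y≡))
  ... | inj₂ (inj₂ (i , y≡ , i+1≡j+2)) =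
    inj₁ (two-at fy≡2 (trans y≡ (cong inj₁ (+ₘ-injective 1 (trans i+1≡j+2 (sym (+ₘ-assoc j 1 1)))))))

  inner-dominated : ∀ j → f (inj₂ (j +ₘ 2)) ≡ 0 →
                    T (two (inj₂ j)) ⊎ T (two (inj₂ (j +ₘ 4))) ⊎ T (two (inj₁ (j +ₘ 2)))
  inner-dominated j f≡0 with dominated (inj₂ (j +ₘ 2)) f≡0
  ... | y , adj , fy≡2 with inner-neighbour adj
  ... | inj₁ y≡ = inj₂ (inj₁ (two-at fy≡2 (trans y≡ (cong inj₂ (+ₘ-assoc j 2 2)))))
  ... | inj₂ (inj₁ y≡) = inj₂ (inj₂ (two-at fy≡2 y≡))
  ... | inj₂ (inj₂ (i , y≡ , i+2≡j+2)) = inj₁ (two-at fy≡2 (trans y≡ (cong inj₂ (+ₘ-injective 2 i+2≡j+2))))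

  column : Fin n → ℕ
  column i = f (inj₁ i) + f (inj₂ i)

  potentialAt : Fin n → ℕ
  potentialAt j = Φ (two (inj₂ j)) (two (inj₁ (j +ₘ 1))) (two (inj₂ (j +ₘ 1)))
                    (two (inj₁ (j +ₘ 2))) (two (inj₂ (j +ₘ 2))) (two (inj₂ (j +ₘ 3)))

  potentialAt-+ₘ1 : ∀ j → potentialAt (j +ₘ 1) ≡
                    Φ (two (inj₂ (j +ₘ 1))) (two (inj₁ (j +ₘ 2))) (two (inj₂ (j +ₘ 2)))
                      (two (inj₁ (j +ₘ 3))) (two (inj₂ (j +ₘ 3))) (two (inj₂ (j +ₘ 4)))
  potentialAt-+ₘ1 j rewrite +ₘ-assoc j 1 1 | +ₘ-assoc j 1 2 | +ₘ-assoc j 1 3 = refl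

  potential-step : ∀ j → 8 + potentialAt j ≤ 7 * column (j +ₘ 2) + potentialAt (j +ₘ 1)
  potential-step j rewrite potentialAt-+ₘ1 j =
    Φ-step (s≤s (bounded _)) (s≤s (bounded _)) _ _ _ _ _ _ (outer-dominated j) (inner-dominated j)

  8n≤7weight : 8 * n ≤ 7 * weight n f
  8n≤7weight = begin
    8 * n                               ≡⟨ *-comm 8 n ⟩
    n * 8                               ≤⟨ potential-lower-bound 8 (λ j → 7 * column (j +ₘ 2)) potentialAt potential-step ⟩
    ∑[ j < n ] (7 * column (j +ₘ 2))    ≡⟨ *-distribˡ-sum 7 (λ j → column (j +ₘ 2)) ⟨
    7 * ∑[ j < n ] column (j +ₘ 2)      ≡⟨ cong (7 *_) (∑-+ₘ column 2) ⟩
    7 * ∑[ j < n ] column j             ≡⟨ cong (7 *_) (weight≡∑columns n f) ⟨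
    7 * weight n f                      ∎
    where open ≤-Reasoning

⌈/⌉-least : ∀ {m} d {w} .{{_ : NonZero d}} → m ≤ d * w → ⌈ m / d ⌉ ≤ w
⌈/⌉-least {m} d@(suc d-1) {w} m≤dw = s≤s⁻¹ (m<n*o⇒m/o<n (begin-strict
  m + d-1      <⟨ +-mono-≤-< m≤dw (n<1+n d-1) ⟩
  d * w + d    ≡⟨ cong (_+ d) (*-comm d w) ⟩
  w * d + d    ≡⟨ +-comm (w * d) d ⟩
  suc w * d    ∎))
  where open ≤-Reasoning

lemma2p11 : (n : ℕ) .{{_ : NonZero n}} → 5 ≤ n → γR≥ n 2 ⌈ 8 * n / 7 ⌉
lemma2p11 n _ f rdf = ⌈/⌉-least 7 (8n≤7weight rdf)
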